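{- Let $r_1 > r_2$ be nonnegative integers and let $T$ be a tournament. Suppose $P = (v_0,v_1,\ldots, v_m)$ is the $r_1$-th power of a path in $T$. Let $\mathcal{S} = \{S_i\}$ be a collection of subsets of $V(T)$ which is $r_1$-apart in $P$ and such that $|S_i|\leq r_2$ for all $i$. Then $P \setminus \bigcup_i S_i$ (with the vertex ordering inherited from $P$) is the $(r_1-r_2)$-th power of a path.
   Context: For an ordered sequence of vertices $(u_0,\ldots,u_l)$ of a tournament $T$, we say it is the $r$-th power of a path if $u_iu_j$ is an edge of $T$ for all $i<j\le i+r$. Let $\pi=(v_0,\ldots,v_m)$ be an ordering of a vertex set $V$ and $\mathcal{S}=\{S_1,\ldots,S_q\}$ a collection of sets. $\mathcal{S}$ is $r$-apart in $\pi$ if for any two distinct $S_i,S_j$, the distance in $\pi$ (i.e. the difference of positions) between any vertex of $S_i\cap V$ and any vertex of $S_j\cap V$ is more than $r$. -}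

module Defs where

open import Data.Nat using (ℕ; _<_; _≤_; _+_; ∣_-_∣)
open import Data.Fin using (Fin; toℕ)
open import Data.Fin.Subset using (Subset; _∈_; ⋃)
open import Data.Fin.Subset.Properties using (_∈?_)
open import Data.List using (List; length; lookup; filter; tabulate)
open import Data.List.Relation.Unary.Unique.Propositional using (Unique)
open import Data.Product using (_×_)
open import Data.Sum using (_⊎_)
open import Relation.Nullary using (¬_)
open import Relation.Nullary.Decidable using (¬?)
open import Relation.Binary.PropositionalEquality using (_≡_; _≢_)

IsTournament : ∀ {n} → (Fin n → Fin n → Set) → Set
IsTournament {n} E =
  (∀ (u : Fin n) → ¬ E u u) ×
  (∀ (u v : Fin n) → u ≢ v → E u v ⊎ E v u) ×
  (∀ (u v : Fin n) → E u v → ¬ E v u)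

IsPowerOfPath : ∀ {n} → (Fin n → Fin n → Set) → ℕ → List (Fin n) → Set
IsPowerOfPath E r us =
  Unique us ×
  (∀ (i j : Fin (length us)) → toℕ i < toℕ j → toℕ j ≤ toℕ i + r →
     E (lookup us i) (lookup us j))

IsApart : ∀ {n q} → ℕ → List (Fin n) → (Fin q → Subset n) → Set
IsApart {n} {q} r P S =
  ∀ (i j : Fin q) → S i ≢ S j →
  ∀ (a b : Fin (length P)) → lookup P a ∈ S i → lookup P b ∈ S j →
  r < ∣ toℕ a - toℕ b ∣

⋃S : ∀ {n q} → (Fin q → Subset n) → Subset n
⋃S S = ⋃ (tabulate S)

removeAll : ∀ {n q} → List (Fin n) → (Fin q → Subset n) → List (Fin n)
removeAll P S = filter (λ x → ¬? (x ∈? ⋃S S)) P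

-- Two survivors that are within distance r₁ − r₂ in P ∖ ⋃ Sᵢ are separated in P by a gap
-- containing fewer than r₁ − r₂ survivors. Were the gap r₁ or more vertices long, its first
-- r₁ vertices would form a window of consecutive vertices of P in which, by r₁-apartness, all
-- removed vertices lie in a single Sᵢ; so at most r₂ of them are removed and at least r₁ − r₂
-- survive, a contradiction. Hence the two survivors are within distance r₁ in P, and P being
-- an r₁-th power of a path joins them by an edge.
module Submission where

open import Defs
open import Data.Nat using (ℕ; _<_; _≤_; _∸_)
open import Data.Fin using (Fin)
open import Data.Fin.Subset using (Subset; ∣_∣)
open import Data.List using (List)

open import Level using (Level)
open import Data.Bool using (_≟_)
open import Data.Empty using (⊥-elim)
open import Data.Nat using (zero; suc; _+_; _⊔_; ∣_-_∣; z≤n; s≤s; s≤s⁻¹; z<s; _≤?_)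
open import Data.Nat.Properties
  using ( +-suc; +-monoʳ-≤; +-mono-<-≤; +-cancelˡ-≤; m<m+n; m∸n+n≡m; ⊔-lub; m≤n⇒m⊓n≡m
        ; ∣m+n-m+o∣≡∣n-o∣; ∣m-n∣≤m⊔n; ≤-reflexive; ≤-trans; ≤-<-trans; n≤1+n
        ; <⇒≤; <⇒≱; ≰⇒>; <-irrefl; module ≤-Reasoning)
open import Data.Fin using (toℕ; zero; suc)
open import Data.Fin.Properties using (toℕ<n)
open import Data.Fin.Subset using (_∈_; _─_; ⁅_⁆)
open import Data.Fin.Subset.Properties
  using (_∈?_; ∉⊥; x∈p∪q⁻; x∈p⇒p-x⊂p; p⊂q⇒∣p∣<∣q∣; x∈p∧x∉q⇒x∈p─q; x∈⁅y⁆⇒x≡y)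
open import Data.List using ([]; _∷_; _++_; [_]; length; lookup; filter; take; drop)
open import Data.List.Properties
  using (filter-accept; filter-reject; length-take; take++drop≡id; ∷-injective; ++-assoc)
open import Data.List.Membership.Propositional using () renaming (_∈_ to _∈ˡ_)
open import Data.List.Relation.Unary.All as All using (All; []; _∷_)
open import Data.List.Relation.Unary.All.Properties using (all-filter)
open import Data.List.Relation.Unary.Any using (here; there)
open import Data.List.Relation.Unary.Unique.Propositional using (Unique)
open import Data.List.Relation.Unary.Unique.Propositional.Properties using (filter⁺)
open import Data.List.Relation.Unary.AllPairs using ([]; _∷_)
open import Data.List.Relation.Binary.Sublist.Propositional using (_⊆_; _⊇_; []; _∷_; _∷ʳ_)
open import Data.List.Relation.Binary.Sublist.Propositional.Properties
  using (All-resp-⊆; Any-resp-⊆; length-mono-≤; take-⊆; filter-⊆; ++⁺ˡ; ++⁺ʳ)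
import Data.List.Relation.Binary.Sublist.Propositional.Properties as Sublist
open import Data.Product using (∃; ∃₂; _×_; _,_)
open import Data.Sum using (inj₁; inj₂)
open import Data.Vec.Properties using (≡-dec)
open import Function using (_∘_)
open import Relation.Binary.Definitions using (_Respects_)
open import Relation.Nullary using (yes; no; contradiction)
open import Relation.Nullary.Decidable using (¬?)
open import Relation.Unary using (Pred; Decidable)
open import Relation.Binary.PropositionalEquality
  using (_≡_; _≢_; refl; sym; trans; cong; subst; module ≡-Reasoning)

private variable
  a p : Level
  A : Set a
  k l n q r s : ℕ
  x y : A
  xs ys zs : List A

data _[_]=_ {A : Set a} : List A → ℕ → A → Set a where
  at : ∀ {xs} (i : Fin (length xs)) → xs [ toℕ i ]= lookup xs i

[]=-∷ : xs [ k ]= y → (x ∷ xs) [ suc k ]= y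
[]=-∷ (at i) = at (suc i)

[]=-middle : ∀ xs → (xs ++ y ∷ ys) [ length xs ]= y
[]=-middle []       = at zero
[]=-middle (x ∷ xs) = []=-∷ ([]=-middle xs)

[]=-++ˡ : xs [ k ]= x → (xs ++ ys) [ k ]= x
[]=-++ˡ {xs = _ ∷ _}  (at zero)    = at zero
[]=-++ˡ {xs = _ ∷ xs} (at (suc i)) = []=-∷ ([]=-++ˡ {xs = xs} (at i))

[]=-++ʳ : ∀ xs → ys [ k ]= y → (xs ++ ys) [ length xs + k ]= y
[]=-++ʳ []       p = p
[]=-++ʳ (x ∷ xs) p = []=-∷ ([]=-++ʳ xs p)

[]=⇒< : xs [ k ]= x → k < length xs
[]=⇒< (at i) = toℕ<n i

∈⇒[]= : x ∈ˡ xs → ∃ λ k → xs [ k ]= x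
∈⇒[]= (here refl)  = 0 , at zero
∈⇒[]= (there x∈xs) with k , p ← ∈⇒[]= x∈xs = suc k , []=-∷ p

lookup-split : ∀ (xs : List A) (j : Fin (length xs)) →
  ∃₂ λ ys zs → xs ≡ ys ++ lookup xs j ∷ zs × length ys ≡ toℕ j
lookup-split (x ∷ xs) zero    = [] , xs , refl , refl
lookup-split (x ∷ xs) (suc j) with ys , zs , eq , len ← lookup-split xs j =
  x ∷ ys , zs , cong (x ∷_) eq , cong suc len

lookup-split₂ : ∀ (xs : List A) (i j : Fin (length xs)) → toℕ i < toℕ j →
  ∃₂ λ ys ms → ∃ λ zs →
    xs ≡ ys ++ lookup xs i ∷ ms ++ lookup xs j ∷ zs × toℕ i + suc (length ms) ≡ toℕ j
lookup-split₂ (x ∷ xs) zero (suc j) _ with ms , zs , eq , len ← lookup-split xs j =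
  [] , ms , zs , cong (x ∷_) eq , cong suc len
lookup-split₂ (x ∷ xs) (suc i) (suc j) (s≤s i<j)
  with ys , ms , zs , eq , len ← lookup-split₂ xs i j i<j =
  x ∷ ys , ms , zs , cong (x ∷_) eq , cong suc len

module _ {P : Pred A p} (P? : Decidable P) where

  filter-split : ∀ xs → filter P? xs ≡ ys ++ x ∷ zs →
    ∃₂ λ ys′ zs′ → xs ≡ ys′ ++ x ∷ zs′ × filter P? ys′ ≡ ys × filter P? zs′ ≡ zs
  filter-split {ys = []}    [] ()
  filter-split {ys = _ ∷ _} [] ()
  filter-split {ys = ys} (z ∷ xs) eq with P? z
  filter-split {ys = ys} (z ∷ xs) eq | no ¬pz
    with ys′ , zs′ , refl , eq-ys , eq-zs ← filter-split xs eq =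
    z ∷ ys′ , zs′ , refl , trans (filter-reject P? ¬pz) eq-ys , eq-zs
  filter-split {ys = []}    (z ∷ xs) eq | yes pz with refl , eq-zs ← ∷-injective eq =
    [] , xs , refl , refl , eq-zs
  filter-split {ys = y ∷ ys} (z ∷ xs) eq | yes pz
    with refl , eq′ ← ∷-injective eq
    with ys′ , zs′ , refl , eq-ys , eq-zs ← filter-split xs eq′ =
    z ∷ ys′ , zs′ , refl , trans (filter-accept P? pz) (cong (z ∷_) eq-ys) , eq-zs

  filter-split₂ : ∀ {ms} xs → filter P? xs ≡ ys ++ x ∷ ms ++ y ∷ zs →
    ∃₂ λ pre mid → ∃ λ post → xs ≡ pre ++ x ∷ mid ++ y ∷ post × filter P? mid ≡ ms
  filter-split₂ xs eq
    with pre , rest , refl , _ , eq-rest ← filter-split xs eq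
    with mid , post , refl , eq-mid , _ ← filter-split rest eq-rest =
    pre , mid , post , refl , eq-mid

  length-filter-complement : ∀ xs →
    length (filter (¬? ∘ P?) xs) + length (filter P? xs) ≡ length xs
  length-filter-complement []       = refl
  length-filter-complement (z ∷ xs) with P? z
  ... | yes _ = trans (+-suc _ _) (cong suc (length-filter-complement xs))
  ... | no  _ = cong suc (length-filter-complement xs)

Unique-resp-⊇ : Unique {A = A} Respects _⊇_
Unique-resp-⊇ []          []           = []
Unique-resp-⊇ (_ ∷ʳ τ)    (_ ∷ u)      = Unique-resp-⊇ τ u
Unique-resp-⊇ (refl ∷ τ)  (x∉ ∷ u)     = All-resp-⊆ τ x∉ ∷ Unique-resp-⊇ τ u

Unique⇒length≤∣∣ : ∀ {B : Subset n} {xs} → Unique xs → All (_∈ B) xs → length xs ≤ ∣ B ∣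
Unique⇒length≤∣∣         {xs = []}     _          _          = z≤n
Unique⇒length≤∣∣ {B = B} {xs = x ∷ xs} (x∉ ∷ u) (x∈B ∷ xs∈B) =
  ≤-trans (s≤s (Unique⇒length≤∣∣ u (All.zipWith ∈B-x (x∉ , xs∈B))))
          (p⊂q⇒∣p∣<∣q∣ (x∈p⇒p-x⊂p x∈B))
  where
  ∈B-x : ∀ {y} → (x ≢ y × y ∈ B) → y ∈ B ─ ⁅ x ⁆
  ∈B-x (x≢y , y∈B) = x∈p∧x∉q⇒x∈p─q y∈B (x≢y ∘ sym ∘ x∈⁅y⁆⇒x≡y x)

∈⋃S⁻ : ∀ (S : Fin q → Subset n) {x} → x ∈ ⋃S S → ∃ λ i → x ∈ S i
∈⋃S⁻ {q = zero}  S x∈ = ⊥-elim (∉⊥ x∈)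
∈⋃S⁻ {q = suc q} S x∈ with x∈p∪q⁻ (S zero) (⋃S (S ∘ suc)) x∈
... | inj₁ x∈S₀ = zero , x∈S₀
... | inj₂ x∈⋃ with i , x∈Sᵢ ← ∈⋃S⁻ (S ∘ suc) x∈⋃ = suc i , x∈Sᵢ

window-distance : ∀ m → k < s → l < s → s ≤ suc r → ∣ m + k - m + l ∣ ≤ r
window-distance {k = k} {l = l} {r = r} m k<s l<s s≤ = begin
  ∣ m + k - m + l ∣ ≡⟨ ∣m+n-m+o∣≡∣n-o∣ m k l ⟩
  ∣ k - l ∣         ≤⟨ ∣m-n∣≤m⊔n k l ⟩
  k ⊔ l             ≤⟨ s≤s⁻¹ (≤-trans (⊔-lub k<s l<s) s≤) ⟩
  r                 ∎
  where open ≤-Reasoning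

module _ {E : Fin n → Fin n → Set} where

  power-edge : ∀ {P x y} → IsPowerOfPath E r P → P [ k ]= x → P [ l ]= y →
    k < l → l ≤ k + r → E x y
  power-edge (_ , edge) (at i) (at j) = edge i j

  power-edge-across : ∀ {x y} pre mid post → IsPowerOfPath E r (pre ++ x ∷ mid ++ y ∷ post) →
    length mid < r → E x y
  power-edge-across pre mid post pp mid<r =
    power-edge pp ([]=-middle pre) ([]=-++ʳ pre ([]=-∷ ([]=-middle mid)))
      (m<m+n (length pre) z<s) (+-monoʳ-≤ (length pre) mid<r)

module _ {S : Fin q → Subset n} where

  apart-close⇒≡ : ∀ {P i j} {u v : Fin n} → IsApart r P S → P [ k ]= u → P [ l ]= v →
    ∣ k - l ∣ ≤ r → u ∈ S i → v ∈ S j → S i ≡ S j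
  apart-close⇒≡ {i = i} {j} apart (at a) (at b) close u∈ v∈
    with ≡-dec _≟_ (S i) (S j)
  ... | yes eq  = eq
  ... | no  neq = contradiction close (<⇒≱ (apart i j neq a b u∈ v∈))

  removed? : Decidable (_∈ ⋃S S)
  removed? x = x ∈? ⋃S S

  apart-window⇒≡ : ∀ pre w post {u v : Fin n} {i j} → IsApart r (pre ++ w ++ post) S →
    length w ≤ suc r → u ∈ˡ w → v ∈ˡ w → u ∈ S i → v ∈ S j → S i ≡ S j
  apart-window⇒≡ pre w post apart w≤ u∈w v∈w
    with k , wk ← ∈⇒[]= u∈w | l , wl ← ∈⇒[]= v∈w =
    apart-close⇒≡ apart (in-window wk) (in-window wl)
      (window-distance (length pre) ([]=⇒< wk) ([]=⇒< wl) w≤)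
    where
    in-window : ∀ {i} {x : Fin n} → w [ i ]= x → (pre ++ w ++ post) [ length pre + i ]= x
    in-window p = []=-++ʳ pre ([]=-++ˡ p)

  removed-in-window≤ : ∀ pre w post → IsApart r (pre ++ w ++ post) S →
    Unique (pre ++ w ++ post) → (∀ i → ∣ S i ∣ ≤ s) → length w ≤ suc r →
    length (filter removed? w) ≤ s
  removed-in-window≤ {s = s} pre w post apart unique small w≤ =
    bound (filter-⊆ removed? w) (all-filter removed? w)
    where
    bound : ∀ {xs} → xs ⊆ w → All (_∈ ⋃S S) xs → length xs ≤ s
    bound {xs = []}     _ _                     = z≤n
    bound {xs = x ∷ xs} τ all-removed@(x∈⋃ ∷ _) with i , x∈Sᵢ ← ∈⋃S⁻ S x∈⋃ =
      ≤-trans (Unique⇒length≤∣∣ (Unique-resp-⊇ (++⁺ˡ pre (++⁺ʳ post τ)) unique)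
                                (All.tabulate ∈Sᵢ))
              (small i)
      where
      ∈Sᵢ : ∀ {v} → v ∈ˡ x ∷ xs → v ∈ S i
      ∈Sᵢ {v} v∈ with j , v∈Sⱼ ← ∈⋃S⁻ S (All.lookup all-removed v∈) =
        subst (v ∈_) (sym (apart-window⇒≡ pre w post apart w≤
          (Any-resp-⊆ τ (here refl)) (Any-resp-⊆ τ v∈) x∈Sᵢ v∈Sⱼ)) v∈Sⱼ

  few-kept⇒short-gap : ∀ pre mid post → s < r → IsApart r (pre ++ mid ++ post) S →
    Unique (pre ++ mid ++ post) → (∀ i → ∣ S i ∣ ≤ s) →
    length (filter (¬? ∘ removed?) mid) < r ∸ s → length mid < r
  few-kept⇒short-gap {s = s} {r = r} pre mid post s<r apart unique small few with r ≤? length mid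
  ... | no  r≰mid = ≰⇒> r≰mid
  ... | yes r≤mid = contradiction r<r (<-irrefl refl)
    where
    window = take r mid
    split : pre ++ mid ++ post ≡ pre ++ window ++ (drop r mid ++ post)
    split = cong (pre ++_) (begin
      mid ++ post                       ≡⟨ cong (_++ post) (take++drop≡id r mid) ⟨
      (window ++ drop r mid) ++ post    ≡⟨ ++-assoc window (drop r mid) post ⟩
      window ++ (drop r mid ++ post)    ∎)
      where open ≡-Reasoning
    length-window : length window ≡ r
    length-window = trans (length-take r mid) (m≤n⇒m⊓n≡m r≤mid)
    kept≤ : length (filter (¬? ∘ removed?) window) ≤ length (filter (¬? ∘ removed?) mid)
    kept≤ = length-mono-≤
      (Sublist.filter⁺ (¬? ∘ removed?) (¬? ∘ removed?) (λ { refl p → p }) (take-⊆ r mid))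
    removed≤ : length (filter removed? window) ≤ s
    removed≤ = removed-in-window≤ pre window (drop r mid ++ post)
      (subst (λ P → IsApart r P S) split apart) (subst Unique split unique) small
      (≤-trans (≤-reflexive length-window) (n≤1+n r))
    r<r : r < r
    r<r = begin-strict
      r                  ≡⟨ length-window ⟨
      length window      ≡⟨ length-filter-complement removed? window ⟨
      length (filter (¬? ∘ removed?) window) + length (filter removed? window)
                         <⟨ +-mono-<-≤ (≤-<-trans kept≤ few) removed≤ ⟩
      r ∸ s + s          ≡⟨ m∸n+n≡m (<⇒≤ s<r) ⟩
      r                  ∎
      where open ≤-Reasoning

  removeAll-edge : ∀ {E : Fin n → Fin n → Set} P {ys x ms y zs} → s < r →
    IsPowerOfPath E r P → IsApart r P S → (∀ i → ∣ S i ∣ ≤ s) →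
    removeAll P S ≡ ys ++ x ∷ ms ++ y ∷ zs → length ms < r ∸ s → E x y
  removeAll-edge {r = r} {E = E} P {x = x} {y = y} s<r pp@(unique , _) apart small split few
    with pre , mid , post , refl , refl ← filter-split₂ (¬? ∘ removed?) P split =
    power-edge-across {E = E} pre mid post pp
      (few-kept⇒short-gap (pre ++ [ x ]) mid (y ∷ post) s<r
        (subst (λ P → IsApart r P S) reassoc apart) (subst Unique reassoc unique) small few)
    where
    reassoc : pre ++ x ∷ mid ++ y ∷ post ≡ (pre ++ [ x ]) ++ mid ++ y ∷ post
    reassoc = sym (++-assoc pre [ x ] (mid ++ y ∷ post))

lemma2p5 : ∀ (r₁ r₂ : ℕ) → r₂ < r₁ →
    ∀ {n : ℕ} (E : Fin n → Fin n → Set) → IsTournament E →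
    ∀ (P : List (Fin n)) → IsPowerOfPath E r₁ P →
    ∀ {q : ℕ} (S : Fin q → Subset n) → IsApart r₁ P S →
    (∀ (i : Fin q) → ∣ S i ∣ ≤ r₂) →
    IsPowerOfPath E (r₁ ∸ r₂) (removeAll P S)
lemma2p5 r₁ r₂ r₂<r₁ E _ P pp@(unique , _) S apart small =
  filter⁺ (¬? ∘ removed? {S = S}) unique , edge
  where
  edge : ∀ i j → toℕ i < toℕ j → toℕ j ≤ toℕ i + (r₁ ∸ r₂) →
    E (lookup (removeAll P S) i) (lookup (removeAll P S) j)
  edge i j i<j j≤ with _ , ms , _ , split , gap ← lookup-split₂ (removeAll P S) i j i<j =
    removeAll-edge {S = S} {E = E} P r₂<r₁ pp apart small split
      (+-cancelˡ-≤ (toℕ i) _ _ (subst (_≤ toℕ i + (r₁ ∸ r₂)) (sym gap) j≤))
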